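{- For integers $p',q',r'$ let $\min(p',q',r';|E|)$ denote the minimum of $|E(G)|$ over all connected finite simple graphs $G$ with $\mathrm{ind\text{ - }match}(G)=p'$, $\mathrm{min\text{ - }match}(G)=q'$ and $\mathrm{match}(G)=r'$. Let $q,r$ be integers with $2\le q\le r\le 2q-2$. Then: (1) $\min(1,q,q;|E|)\le q^2$; (2) $\min(1,q,q+1;|E|)\le q^2+2$; (3) if $q+2\le r\le 2q-2$, then $\min(1,q,r;|E|)\le \min\{f_1(q,r),f_2(q,r)\}$, where $f_1(q,r)=r(q-1)+\binom{r-q+2}{2}$ and $f_2(q,r)=2(r-q)+\binom{2q}{2}$.
   Context: All graphs are finite and simple. A matching of $G$ is a set of pairwise disjoint edges. A maximal matching is a matching not properly contained in another matching. An induced matching is a matching $M$ such that for distinct $e,f\in M$ there is no edge $g$ of $G$ meeting both $e$ and $f$. $\mathrm{match}(G)$ is the maximum size of a matching, $\mathrm{min\text{ - }match}(G)$ the minimum size of a maximal matching, and $\mathrm{ind\text{ - }match}(G)$ the maximum size of an induced matching of $G$. -}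

module Defs where

open import Data.Nat using (ℕ; zero; suc; _+_; _<_; _≤_; _≥_; _<ᵇ_)
open import Data.Bool using (Bool; true; false; _∧_; if_then_else_)
open import Data.Fin using (Fin; toℕ)
open import Data.List using (List; []; _∷_; length; map; allFin)
open import Data.Nat.ListAction using (sum)
open import Data.List.Membership.Propositional using (_∈_)
open import Data.List.Relation.Unary.All using (All)
open import Data.List.Relation.Unary.AllPairs using (AllPairs)
open import Data.Product using (Σ; ∃; _×_; _,_; proj₁; proj₂)
open import Data.Sum using (_⊎_)
open import Relation.Binary.PropositionalEquality using (_≡_)
open import Relation.Nullary using (¬_)

record Graph : Set where
  field
    n    : ℕ
    adj  : Fin n → Fin n → Bool
    irrefl : ∀ u → adj u u ≡ false
    sym    : ∀ u v → adj u v ≡ adj v u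

open Graph public

-- An edge {u,v} is represented canonically by the ordered pair (u , v) with u < v.
Pair : Graph → Set
Pair G = Fin (n G) × Fin (n G)

IsEdge : (G : Graph) → Pair G → Set
IsEdge G (u , v) = (toℕ u < toℕ v) × (adj G u v ≡ true)

edgeCount : Graph → ℕ
edgeCount G = sum (map (λ u → sum (map (λ v →
  if (toℕ u <ᵇ toℕ v) ∧ adj G u v then 1 else 0) (allFin (n G)))) (allFin (n G)))

Meets : (G : Graph) → Pair G → Pair G → Set
Meets G (a , b) (c , d) = (a ≡ c) ⊎ (a ≡ d) ⊎ (b ≡ c) ⊎ (b ≡ d)

Disjoint : (G : Graph) → Pair G → Pair G → Set
Disjoint G e f = ¬ Meets G e f

-- A matching: a list of edges, pairwise (at distinct positions) vertex-disjoint.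
-- (Pairwise disjointness forbids repetitions, so the length is the size.)
IsMatching : (G : Graph) → List (Pair G) → Set
IsMatching G M = All (IsEdge G) M × AllPairs (Disjoint G) M

_⊆_ : {A : Set} → List A → List A → Set
M ⊆ M' = ∀ {e} → e ∈ M → e ∈ M'

IsMaximalMatching : (G : Graph) → List (Pair G) → Set
IsMaximalMatching G M =
  IsMatching G M × (∀ M' → IsMatching G M' → M ⊆ M' → M' ⊆ M)

NoEdgeMeetsBoth : (G : Graph) → Pair G → Pair G → Set
NoEdgeMeetsBoth G e f = ∀ g → IsEdge G g → ¬ (Meets G g e × Meets G g f)

IsInducedMatching : (G : Graph) → List (Pair G) → Set
IsInducedMatching G M = IsMatching G M × AllPairs (NoEdgeMeetsBoth G) M

MatchNumber : Graph → ℕ → Set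
MatchNumber G k =
  (Σ (List (Pair G)) λ M → IsMatching G M × length M ≡ k) ×
  (∀ M → IsMatching G M → length M ≤ k)

MinMatchNumber : Graph → ℕ → Set
MinMatchNumber G k =
  (Σ (List (Pair G)) λ M → IsMaximalMatching G M × length M ≡ k) ×
  (∀ M → IsMaximalMatching G M → k ≤ length M)

IndMatchNumber : Graph → ℕ → Set
IndMatchNumber G k =
  (Σ (List (Pair G)) λ M → IsInducedMatching G M × length M ≡ k) ×
  (∀ M → IsInducedMatching G M → length M ≤ k)

data Walk (G : Graph) : Fin (n G) → Fin (n G) → Set where
  here : ∀ {u} → Walk G u u
  step : ∀ {u v w} → adj G u v ≡ true → Walk G v w → Walk G u w

Connected : Graph → Set
Connected G = ∀ u v → Walk G u v

-- "min(p,q,r;|E|) ≤ N": some connected graph with ind-match = p,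
-- min-match = q, match = r has at most N edges.
MinEdgesAtMost : ℕ → ℕ → ℕ → ℕ → Set
MinEdgesAtMost p q r N = Σ Graph λ G →
  Connected G × IndMatchNumber G p × MinMatchNumber G q × MatchNumber G r ×
  edgeCount G ≤ N

{-# OPTIONS --safe #-}

-- With m = r − q ≤ q, take K_{q,q} on X = {x_i} and Y = {y_i} (i < q) and hang a half graph on each side:
-- new vertices a_j, b_j (j < m) with x_i ~ a_j and y_i ~ b_j whenever i ≤ j. This graph has q² + m(m + 1) edges.
-- Any two edges are joined by a third: by an X–Y edge, or, for two edges of one half graph, because i ≤ j and
-- i' ≤ j' force i ≤ j' or i' ≤ j; so ind-match = 1. A maximal matching that missed a vertex of X and a vertex
-- of Y could be extended by the edge between them, so it covers one of these independent q-sets and has at least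
-- q edges, and the q edges x_i y_i form such a matching. The edges x_j a_j, y_j b_j (j < m) and x_i y_i
-- (m ≤ i < q) form a perfect matching, so match = q + m. For m = 0, 1 this gives (1) and (2), and for
-- 2 ≤ m ≤ q − 2 the count q² + m(m + 1) is at most f₁(q, r) and f₂(q, r).

module Submission where

open import Defs
open import Data.Nat using (ℕ; _+_; _*_; _∸_; _≤_; _⊓_)
open import Data.Nat.Combinatorics using (_C_)
open import Data.Product using (_×_)

open import Data.Bool using (Bool; true; false; _∧_; if_then_else_)
open import Data.Bool.Properties using (∨-comm; ∧-zeroʳ)
open import Data.Empty using (⊥; ⊥-elim)
open import Data.Fin using (Fin; zero; suc; toℕ; fromℕ<; _↑ˡ_; _↑ʳ_; splitAt; join; _≟_)
open import Data.Fin.Properties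
  using (toℕ<n; toℕ-injective; toℕ-↑ˡ; toℕ-↑ʳ; splitAt-↑ˡ; splitAt-↑ʳ; splitAt⁻¹-↑ˡ; splitAt⁻¹-↑ʳ; join-splitAt)
open import Data.List using (List; []; _∷_; [_]; _++_; length; map; tabulate; allFin)
open import Data.List.Properties using (length-map; length-tabulate; map-tabulate; map-cong; length-++-sucʳ)
open import Data.List.Membership.Propositional using (_∈_; _∉_; find)
open import Data.List.Membership.Propositional.Properties using (∈-map⁺; ∈-map⁻; ∈-allFin; ∈-∃++)
open import Data.List.Relation.Unary.All as All using (All; []; _∷_; all?)
open import Data.List.Relation.Unary.All.Properties using (¬All⇒Any¬) renaming (map⁺ to All-map⁺)
open import Data.List.Relation.Unary.AllPairs as AllPairs using (AllPairs; []; _∷_)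
open import Data.List.Relation.Unary.AllPairs.Properties using () renaming (map⁺ to AllPairs-map⁺)
open import Data.List.Relation.Unary.Any using (here; there; any?)
open import Data.List.Relation.Unary.Unique.Propositional using (Unique)
open import Data.List.Relation.Unary.Unique.Propositional.Properties using (allFin⁺) renaming (map⁺ to Unique-map⁺)
open import Data.Maybe using (Maybe; just; nothing)
open import Data.Maybe.Properties using (just-injective)
open import Data.Nat using (zero; suc; s≤s; s≤s⁻¹; z≤n; _<_; _<ᵇ_; _≤?_; _<?_)
open import Data.Nat.Properties
  using (≤-reflexive; ≤-trans; <-≤-trans; <⇒≤; <⇒≢; ≰⇒>; ≮⇒≥; ≤∧≢⇒<; <-asym; m≤m+n; +-monoʳ-<; +-assoc;
         +-identityʳ; +-cancelˡ-≤; *-identityʳ; *-suc; *-distribˡ-+; *-cancelˡ-≤; 0∸n≡0; m+n∸m≡n;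
         m≤o∸n⇒m+n≤o; m≤n⇒∃[o]m+o≡n; ⊓-glb; +-0-commutativeMonoid; module ≤-Reasoning)
open import Algebra.Properties.CommutativeMonoid.Sum +-0-commutativeMonoid
  using (sum; sum-syntax; sum-cong-≗; sum-replicate-zero; ∑-distrib-+)
open import Data.Nat.Combinatorics using (nC1≡n; nCk+nC[k+1]≡[n+1]C[k+1])
import Data.Nat.ListAction as ListAction
open import Data.Nat.Tactic.RingSolver using (solve-∀)
open import Data.Product using (∃-syntax; ∃₂; _,_; proj₁; proj₂)
open import Data.Sum using (_⊎_; inj₁; inj₂; [_,_]′)
open import Function using (_∘_; id; mk⇔)
open import Relation.Nullary using (¬_; Dec; yes; no; does)
open import Relation.Nullary.Decidable using (dec-true; dec-false; does-⇔; map′; _⊎-dec_)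
import Relation.Binary.PropositionalEquality as ≡
open ≡ using (_≡_; _≢_; refl; cong; cong₂; subst; subst₂; trans)

Unique-⊆⇒length≤ : {A : Set} {xs ys : List A} → Unique xs → xs ⊆ ys → length xs ≤ length ys
Unique-⊆⇒length≤ {xs = []} _ _ = z≤n
Unique-⊆⇒length≤ {xs = x ∷ xs} (x∉xs ∷ xs-unique) xs⊆ys with ∈-∃++ (xs⊆ys (here refl))
... | ys₁ , ys₂ , refl = subst (suc (length xs) ≤_) (≡.sym (length-++-sucʳ ys₁ x ys₂))
  (s≤s (Unique-⊆⇒length≤ xs-unique (λ z∈xs → remove x (All.lookup x∉xs z∈xs) (xs⊆ys (there z∈xs)))))
  where
  remove : ∀ {A : Set} {z} x {ys₁ ys₂ : List A} → x ≢ z → z ∈ ys₁ ++ x ∷ ys₂ → z ∈ ys₁ ++ ys₂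
  remove x {[]} x≢z (here z≡x) = ⊥-elim (x≢z (≡.sym z≡x))
  remove x {[]} x≢z (there z∈) = z∈
  remove x {_ ∷ _} x≢z (here z≡y) = here z≡y
  remove x {_ ∷ _} x≢z (there z∈) = there (remove x x≢z z∈)

AllPairs-lookup : {A : Set} {R : A → A → Set} {xs : List A} {x y : A} →
                  AllPairs R xs → x ∈ xs → y ∈ xs → x ≡ y ⊎ R x y ⊎ R y x
AllPairs-lookup (_ ∷ _) (here refl) (here refl) = inj₁ refl
AllPairs-lookup (Rx ∷ _) (here refl) (there y∈) = inj₂ (inj₁ (All.lookup Rx y∈))
AllPairs-lookup (Rx ∷ _) (there x∈) (here refl) = inj₂ (inj₂ (All.lookup Rx x∈))
AllPairs-lookup (_ ∷ R-xs) (there x∈) (there y∈) = AllPairs-lookup R-xs x∈ y∈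

dec-true⁻¹ : {P : Set} (p? : Dec P) → does p? ≡ true → P
dec-true⁻¹ (yes p) _ = p

≤-crossed : ∀ {a b c d} → a ≤ b → c ≤ d → a ≤ d ⊎ c ≤ b
≤-crossed {a} {b} {c} {d} a≤b c≤d with a ≤? d
... | yes a≤d = inj₁ a≤d
... | no a≰d = inj₂ (≤-trans c≤d (≤-trans (<⇒≤ (≰⇒> a≰d)) a≤b))

𝟙 : Bool → ℕ
𝟙 b = if b then 1 else 0

sum-tabulate : ∀ {k} (f : Fin k → ℕ) → ListAction.sum (tabulate f) ≡ sum f
sum-tabulate {zero} f = refl
sum-tabulate {suc k} f = cong (f zero +_) (sum-tabulate (f ∘ suc))

sum-allFin : ∀ {k} (f : Fin k → ℕ) → ListAction.sum (map f (allFin k)) ≡ sum f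
sum-allFin f = trans (cong ListAction.sum (map-tabulate id f)) (sum-tabulate f)

sum-↑ : ∀ k l (f : Fin (k + l) → ℕ) → sum f ≡ ∑[ i < k ] f (i ↑ˡ l) + ∑[ j < l ] f (k ↑ʳ j)
sum-↑ zero l f = refl
sum-↑ (suc k) l f = trans (cong (f zero +_) (sum-↑ k l (f ∘ suc))) (≡.sym (+-assoc (f zero) _ _))

sum-const : ∀ k c → ∑[ i < k ] c ≡ k * c
sum-const zero c = refl
sum-const (suc k) c = cong (c +_) (sum-const k c)

sum-count-≤ : ∀ k l → ∑[ j < k ] 𝟙 (does (l ≤? toℕ j)) ≡ k ∸ l
sum-count-≤ zero l = ≡.sym (0∸n≡0 l)
sum-count-≤ (suc k) zero = cong suc (sum-count-≤ k zero)
sum-count-≤ (suc k) (suc l) = trans (sum-cong-≗ {k} shift) (sum-count-≤ k l)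
  where
  shift : ∀ j → 𝟙 (does (suc l ≤? suc (toℕ j))) ≡ 𝟙 (does (l ≤? toℕ j))
  shift j = cong 𝟙 (does-⇔ (mk⇔ s≤s⁻¹ s≤s) (suc l ≤? suc (toℕ j)) (l ≤? toℕ j))

sum-∸ : ∀ {k l} → k ≤ l → ∑[ i < l ] (k ∸ toℕ i) ≡ suc k C 2
sum-∸ {zero} {l} _ = trans (sum-cong-≗ {l} (0∸n≡0 ∘ toℕ)) (sum-replicate-zero l)
sum-∸ {suc k} {suc l} (s≤s k≤l) = begin
  suc k + ∑[ i < l ] (k ∸ toℕ i)  ≡⟨ cong (suc k +_) (sum-∸ k≤l) ⟩
  suc k + suc k C 2               ≡⟨ cong (_+ suc k C 2) (nC1≡n (suc k)) ⟨
  suc k C 1 + suc k C 2           ≡⟨ nCk+nC[k+1]≡[n+1]C[k+1] (suc k) 1 ⟩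
  suc (suc k) C 2                 ∎
  where open ≡.≡-Reasoning

2*nC2≡n*[n∸1] : ∀ k → 2 * (k C 2) ≡ k * (k ∸ 1)
2*nC2≡n*[n∸1] 0 = refl
2*nC2≡n*[n∸1] 1 = refl
2*nC2≡n*[n∸1] (suc (suc k)) = begin
  2 * (suc (suc k) C 2)              ≡⟨ cong (2 *_) (nCk+nC[k+1]≡[n+1]C[k+1] (suc k) 1) ⟨
  2 * (suc k C 1 + suc k C 2)        ≡⟨ *-distribˡ-+ 2 (suc k C 1) _ ⟩
  2 * (suc k C 1) + 2 * (suc k C 2)  ≡⟨ cong₂ (λ a b → 2 * a + b) (nC1≡n (suc k)) (2*nC2≡n*[n∸1] (suc k)) ⟩
  2 * suc k + suc k * k              ≡⟨ regroup k ⟩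
  suc (suc k) * suc k                ∎
  where
  open ≡.≡-Reasoning
  regroup : ∀ k → 2 * suc k + suc k * k ≡ suc (suc k) * suc k
  regroup = solve-∀

Vertex : Graph → Set
Vertex G = Fin (n G)

_∈ᵉ_ : {V : Set} → V → V × V → Set
w ∈ᵉ (u , v) = w ≡ u ⊎ w ≡ v

endpoints : {V : Set} → List (V × V) → List V
endpoints [] = []
endpoints ((u , v) ∷ M) = u ∷ v ∷ endpoints M

Independent : (G : Graph) → List (Vertex G) → Set
Independent G S = ∀ {u v} → u ∈ S → v ∈ S → adj G u v ≡ false

MinEdgesAtMost-mono : ∀ {p q r k l} → k ≤ l → MinEdgesAtMost p q r k → MinEdgesAtMost p q r l
MinEdgesAtMost-mono k≤l (G , connected , ind , min , match , size) =
  G , connected , ind , min , match , ≤-trans size k≤l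

module _ {G : Graph} where

  meets : ∀ {w} {e f : Pair G} → w ∈ᵉ e → w ∈ᵉ f → Meets G e f
  meets {e = _ , _} {f = _ , _} (inj₁ refl) (inj₁ refl) = inj₁ refl
  meets {e = _ , _} {f = _ , _} (inj₁ refl) (inj₂ refl) = inj₂ (inj₁ refl)
  meets {e = _ , _} {f = _ , _} (inj₂ refl) (inj₁ refl) = inj₂ (inj₂ (inj₁ refl))
  meets {e = _ , _} {f = _ , _} (inj₂ refl) (inj₂ refl) = inj₂ (inj₂ (inj₂ refl))

  meets⁻ : ∀ {e f : Pair G} → Meets G e f → ∃[ w ] w ∈ᵉ e × w ∈ᵉ f
  meets⁻ {u , _} {_ , _} (inj₁ u≡w) = u , inj₁ refl , inj₁ u≡w
  meets⁻ {u , _} {_ , _} (inj₂ (inj₁ u≡z)) = u , inj₁ refl , inj₂ u≡z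
  meets⁻ {_ , v} {_ , _} (inj₂ (inj₂ (inj₁ v≡w))) = v , inj₂ refl , inj₁ v≡w
  meets⁻ {_ , v} {_ , _} (inj₂ (inj₂ (inj₂ v≡z))) = v , inj₂ refl , inj₂ v≡z

  meets-sym : ∀ {e f : Pair G} → Meets G e f → Meets G f e
  meets-sym e-meets-f = let _ , w∈e , w∈f = meets⁻ e-meets-f in meets w∈f w∈e

  ∈-endpoints⁺ : ∀ {M : List (Pair G)} {e w} → e ∈ M → w ∈ᵉ e → w ∈ endpoints M
  ∈-endpoints⁺ {(u , v) ∷ M} (here refl) (inj₁ refl) = here refl
  ∈-endpoints⁺ {(u , v) ∷ M} (here refl) (inj₂ refl) = there (here refl)
  ∈-endpoints⁺ {(u , v) ∷ M} (there e∈M) w∈e = there (there (∈-endpoints⁺ e∈M w∈e))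

  ∈-endpoints⁻ : ∀ {M : List (Pair G)} {w} → w ∈ endpoints M → ∃[ e ] e ∈ M × w ∈ᵉ e
  ∈-endpoints⁻ {(u , v) ∷ M} (here w≡u) = (u , v) , here refl , inj₁ w≡u
  ∈-endpoints⁻ {(u , v) ∷ M} (there (here w≡v)) = (u , v) , here refl , inj₂ w≡v
  ∈-endpoints⁻ {(u , v) ∷ M} (there (there w∈)) =
    let e , e∈M , w∈e = ∈-endpoints⁻ w∈ in e , there e∈M , w∈e

  length-endpoints : ∀ (M : List (Pair G)) → length (endpoints M) ≡ 2 * length M
  length-endpoints [] = refl
  length-endpoints (_ ∷ M) = trans (cong (2 +_) (length-endpoints M)) (≡.sym (*-suc 2 (length M)))

  _◅◅_ : ∀ {u v w} → Walk G u v → Walk G v w → Walk G u w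
  here ◅◅ q = q
  step e p ◅◅ q = step e (p ◅◅ q)

  reverse : ∀ {u v} → Walk G u v → Walk G v u
  reverse here = here
  reverse (step {u} {v} uv p) = reverse p ◅◅ step (trans (sym G v u) uv) here

  connected-via : (c : Vertex G) → (∀ u → Walk G u c) → Connected G
  connected-via c to-c u v = to-c u ◅◅ reverse (to-c v)

  oriented : ∀ {u v} → adj G u v ≡ true → IsEdge G (u , v) ⊎ IsEdge G (v , u)
  oriented {u} {v} uv with toℕ u <? toℕ v
  ... | yes u<v = inj₁ (u<v , uv)
  ... | no u≮v = inj₂ (≤∧≢⇒< (≮⇒≥ u≮v) (u≢v ∘ toℕ-injective ∘ ≡.sym) , trans (sym G v u) uv)
    where
    u≢v : u ≢ v
    u≢v refl with () ← trans (≡.sym uv) (irrefl G u)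

  linked-by-adjacent : ∀ {s t} {e f : Pair G} → adj G s t ≡ true → s ∈ᵉ e → t ∈ᵉ f →
                       ∃[ g ] IsEdge G g × Meets G g e × Meets G g f
  linked-by-adjacent {s} {t} st s∈e t∈f with oriented st
  ... | inj₁ st-edge = (s , t) , st-edge , meets (inj₁ refl) s∈e , meets (inj₂ refl) t∈f
  ... | inj₂ ts-edge = (t , s) , ts-edge , meets (inj₂ refl) s∈e , meets (inj₁ refl) t∈f

  matching-endpoints-unique : ∀ {M} → IsMatching G M → Unique (endpoints M)
  matching-endpoints-unique {[]} _ = []
  matching-endpoints-unique {(u , v) ∷ M} ((uv-edge ∷ edges) , (uv-apart ∷ apart)) =
    (u≢v ∷ All.tabulate (fresh (inj₁ refl))) ∷ All.tabulate (fresh (inj₂ refl))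
      ∷ matching-endpoints-unique (edges , apart)
    where
    u≢v : u ≢ v
    u≢v = <⇒≢ (proj₁ uv-edge) ∘ cong toℕ
    fresh : ∀ {w w'} → w ∈ᵉ (u , v) → w' ∈ endpoints M → w ≢ w'
    fresh w∈uv w'∈ refl = let _ , f∈M , w∈f = ∈-endpoints⁻ w'∈ in All.lookup uv-apart f∈M (meets w∈uv w∈f)

  matching-length : ∀ {M} → IsMatching G M → 2 * length M ≤ n G
  matching-length {M} M-matching = begin
    2 * length M                ≡⟨ length-endpoints M ⟨
    length (endpoints M)        ≤⟨ Unique-⊆⇒length≤ (matching-endpoints-unique M-matching) (λ {w} _ → ∈-allFin w) ⟩
    length (allFin (n G))       ≡⟨ length-tabulate id ⟩
    n G                         ∎
    where open ≤-Reasoning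

  induced-matching-length≤1 : (∀ {e f} → IsEdge G e → IsEdge G f → ∃[ g ] IsEdge G g × Meets G g e × Meets G g f) →
                              ∀ {M} → IsInducedMatching G M → length M ≤ 1
  induced-matching-length≤1 linked {[]} _ = z≤n
  induced-matching-length≤1 linked {_ ∷ []} _ = s≤s z≤n
  induced-matching-length≤1 linked {_ ∷ _ ∷ _} (((e-edge ∷ f-edge ∷ _) , _) , ((e-f-apart ∷ _) ∷ _)) =
    let g , g-edge , g-meets-e , g-meets-f = linked e-edge f-edge
    in ⊥-elim (e-f-apart g g-edge (g-meets-e , g-meets-f))

  ind-match-number-1 : ∀ {e} → IsEdge G e →
                       (∀ {e f} → IsEdge G e → IsEdge G f → ∃[ g ] IsEdge G g × Meets G g e × Meets G g f) →
                       IndMatchNumber G 1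
  ind-match-number-1 {e} e-edge linked =
    ([ e ] , (((e-edge ∷ []) , ([] ∷ [])) , ([] ∷ [])) , refl) , λ M → induced-matching-length≤1 linked

  labelled-matching : {I : Set} (e : I → Pair G) (label : Vertex G → Maybe I) →
                      (∀ i → IsEdge G (e i)) → (∀ i {w} → w ∈ᵉ e i → label w ≡ just i) →
                      ∀ {is} → Unique is → IsMatching G (map e is)
  labelled-matching e label edge labelled {is} is-unique =
    All-map⁺ (All.universal edge is) , AllPairs-map⁺ (AllPairs.map apart is-unique)
    where
    apart : ∀ {i j} → i ≢ j → Disjoint G (e i) (e j)
    apart i≢j ei-meets-ej =
      let _ , w∈i , w∈j = meets⁻ ei-meets-ej
      in i≢j (just-injective (trans (≡.sym (labelled _ w∈i)) (labelled _ w∈j)))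

  covering⇒maximal : ∀ {M} → IsMatching G M → (∀ {e} → IsEdge G e → ∃[ f ] f ∈ M × Meets G e f) →
                     IsMaximalMatching G M
  covering⇒maximal {M} M-matching covers = M-matching , inside
    where
    inside : ∀ M' → IsMatching G M' → M ⊆ M' → M' ⊆ M
    inside M' (edges' , apart') M⊆M' e∈M' with covers (All.lookup edges' e∈M')
    ... | f , f∈M , e-meets-f with AllPairs-lookup apart' e∈M' (M⊆M' f∈M)
    ...   | inj₁ refl = f∈M
    ...   | inj₂ (inj₁ e-f-apart) = ⊥-elim (e-f-apart e-meets-f)
    ...   | inj₂ (inj₂ f-e-apart) = ⊥-elim (f-e-apart (meets-sym e-meets-f))

  free-edge-extends : ∀ {M u v} → IsMatching G M → IsEdge G (u , v) →
                      u ∉ endpoints M → v ∉ endpoints M → IsMatching G ((u , v) ∷ M)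
  free-edge-extends {M} {u} {v} (edges , apart) uv-edge u∉ v∉ = (uv-edge ∷ edges) , (All.tabulate apart-from ∷ apart)
    where
    apart-from : ∀ {f} → f ∈ M → Disjoint G (u , v) f
    apart-from f∈M uv-meets-f with meets⁻ uv-meets-f
    ... | _ , inj₁ refl , w∈f = u∉ (∈-endpoints⁺ f∈M w∈f)
    ... | _ , inj₂ refl , w∈f = v∉ (∈-endpoints⁺ f∈M w∈f)

  maximal⇒covers-edge : ∀ {M u v} → IsMaximalMatching G M → adj G u v ≡ true →
                        u ∈ endpoints M ⊎ v ∈ endpoints M
  maximal⇒covers-edge {M} {u} {v} (M-matching , maximal) uv
    with any? (u ≟_) (endpoints M) | any? (v ≟_) (endpoints M)
  ... | yes u∈ | _ = inj₁ u∈
  ... | no _ | yes v∈ = inj₂ v∈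
  ... | no u∉ | no v∉ = ⊥-elim ([ (λ uv-edge → no-free-edge uv-edge u∉ v∉) , (λ vu-edge → no-free-edge vu-edge v∉ u∉) ]′ (oriented uv))
    where
    no-free-edge : ∀ {s t} → IsEdge G (s , t) → s ∉ endpoints M → t ∉ endpoints M → ⊥
    no-free-edge st-edge s∉ t∉ =
      s∉ (∈-endpoints⁺ (maximal _ (free-edge-extends M-matching st-edge s∉ t∉) there (here refl)) (inj₁ refl))

  maximal-matching-covers-side : ∀ {M S T} → IsMaximalMatching G M →
                                 (∀ {s t} → s ∈ S → t ∈ T → adj G s t ≡ true) →
                                 S ⊆ endpoints M ⊎ T ⊆ endpoints M
  maximal-matching-covers-side {M} {S} {T} M-maximal complete with all? (λ s → any? (s ≟_) (endpoints M)) S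
  ... | yes S-covered = inj₁ (All.lookup S-covered)
  ... | no S-uncovered =
    let s , s∈S , s∉ = find (¬All⇒Any¬ (λ s → any? (s ≟_) (endpoints M)) S S-uncovered)
    in inj₂ λ t∈T → [ ⊥-elim ∘ s∉ , id ]′ (maximal⇒covers-edge M-maximal (complete s∈S t∈T))

  independent-cover-length : ∀ {M S} → All (IsEdge G) M → Unique S → Independent G S →
                             S ⊆ endpoints M → length S ≤ length M
  independent-cover-length {M} {S} edges S-unique S-independent S⊆ = begin
    length S              ≤⟨ Unique-⊆⇒length≤ S-unique S⊆choices ⟩
    length (map choose M) ≡⟨ length-map choose M ⟩
    length M              ∎
    where
    open ≤-Reasoning
    choose : Pair G → Vertex G
    choose (u , v) with any? (u ≟_) S
    ... | yes _ = u
    ... | no _ = v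
    chosen : ∀ {e s} → e ∈ M → s ∈ S → s ∈ᵉ e → choose e ≡ s
    chosen {u , v} _ s∈S (inj₁ refl) with any? (u ≟_) S
    ... | yes _ = refl
    ... | no u∉S = ⊥-elim (u∉S s∈S)
    chosen {u , v} e∈M s∈S (inj₂ refl) with any? (u ≟_) S
    ... | yes u∈S with () ← trans (≡.sym (proj₂ (All.lookup edges e∈M))) (S-independent u∈S s∈S)
    ... | no _ = refl
    S⊆choices : S ⊆ map choose M
    S⊆choices s∈S =
      let e , e∈M , s∈e = ∈-endpoints⁻ (S⊆ s∈S)
      in subst (_∈ map choose M) (chosen e∈M s∈S s∈e) (∈-map⁺ choose e∈M)

  edgeCount≡∑ : edgeCount G ≡ ∑[ u < n G ] ∑[ v < n G ] 𝟙 ((toℕ u <ᵇ toℕ v) ∧ adj G u v)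
  edgeCount≡∑ =
    trans (cong ListAction.sum (map-cong (λ u → sum-allFin (row u)) (allFin (n G)))) (sum-allFin (sum ∘ row))
    where
    row : Vertex G → Vertex G → ℕ
    row u v = 𝟙 ((toℕ u <ᵇ toℕ v) ∧ adj G u v)

-- q = m + d: splitting Fin q as Fin m ⊎ Fin d separates the vertices of X and Y that the perfect matching
-- sends into the half graphs from the rest.
module KqqWithHalfGraphs (m d : ℕ) where

  q : ℕ
  q = m + d

  data Part : Set where
    X Y : Fin q → Part
    A B : Fin m → Part

  data Arc : Part → Part → Set where
    X→Y : ∀ {i j} → Arc (X i) (Y j)
    X→A : ∀ {i j} → toℕ i ≤ toℕ j → Arc (X i) (A j)
    Y→B : ∀ {i j} → toℕ i ≤ toℕ j → Arc (Y i) (B j)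

  arc? : ∀ p p' → Dec (Arc p p')
  arc? (X i) (Y j) = yes X→Y
  arc? (X i) (A j) = map′ X→A (λ { (X→A i≤j) → i≤j }) (toℕ i ≤? toℕ j)
  arc? (Y i) (B j) = map′ Y→B (λ { (Y→B i≤j) → i≤j }) (toℕ i ≤? toℕ j)
  arc? (X i) (X j) = no λ ()
  arc? (X i) (B j) = no λ ()
  arc? (Y i) (X j) = no λ ()
  arc? (Y i) (Y j) = no λ ()
  arc? (Y i) (A j) = no λ ()
  arc? (A i) _ = no λ ()
  arc? (B i) _ = no λ ()

  arc-irreflexive : ∀ {p} → ¬ Arc p p
  arc-irreflexive ()

  Adjacent : Part → Part → Set
  Adjacent p p' = Arc p p' ⊎ Arc p' p

  adjacent? : ∀ p p' → Dec (Adjacent p p')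
  adjacent? p p' = arc? p p' ⊎-dec arc? p' p

  N : ℕ
  N = q + q + m + m

  -- Numbering the parts in the order X, Y, A, B makes every arc increase (arc-increasing), so that edgeCount,
  -- which counts each edge from its smaller end, counts exactly the arcs.
  vertex : Part → Fin N
  vertex (X i) = i ↑ˡ q ↑ˡ m ↑ˡ m
  vertex (Y i) = (q ↑ʳ i) ↑ˡ m ↑ˡ m
  vertex (A j) = (q + q ↑ʳ j) ↑ˡ m
  vertex (B j) = q + q + m ↑ʳ j

  part : Fin N → Part
  part u with splitAt (q + q + m) u
  ... | inj₂ j = B j
  ... | inj₁ u₁ with splitAt (q + q) u₁
  ...   | inj₂ j = A j
  ...   | inj₁ u₂ with splitAt q u₂
  ...     | inj₁ i = X i
  ...     | inj₂ i = Y i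

  part-vertex : ∀ p → part (vertex p) ≡ p
  part-vertex (X i) rewrite splitAt-↑ˡ (q + q + m) (i ↑ˡ q ↑ˡ m) m | splitAt-↑ˡ (q + q) (i ↑ˡ q) m
                          | splitAt-↑ˡ q i q = refl
  part-vertex (Y i) rewrite splitAt-↑ˡ (q + q + m) ((q ↑ʳ i) ↑ˡ m) m | splitAt-↑ˡ (q + q) (q ↑ʳ i) m
                          | splitAt-↑ʳ q q i = refl
  part-vertex (A j) rewrite splitAt-↑ˡ (q + q + m) (q + q ↑ʳ j) m | splitAt-↑ʳ (q + q) m j = refl
  part-vertex (B j) rewrite splitAt-↑ʳ (q + q + m) m j = refl

  vertex-part : ∀ u → vertex (part u) ≡ u
  vertex-part u with splitAt (q + q + m) u in eq₁
  ... | inj₂ j = splitAt⁻¹-↑ʳ eq₁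
  ... | inj₁ u₁ with splitAt (q + q) u₁ in eq₂
  ...   | inj₂ j = trans (cong (_↑ˡ m) (splitAt⁻¹-↑ʳ eq₂)) (splitAt⁻¹-↑ˡ eq₁)
  ...   | inj₁ u₂ with splitAt q u₂ in eq₃
  ...     | inj₁ i = trans (cong (λ w → w ↑ˡ m ↑ˡ m) (splitAt⁻¹-↑ˡ eq₃))
                       (trans (cong (_↑ˡ m) (splitAt⁻¹-↑ˡ eq₂)) (splitAt⁻¹-↑ˡ eq₁))
  ...     | inj₂ i = trans (cong (λ w → w ↑ˡ m ↑ˡ m) (splitAt⁻¹-↑ʳ eq₃))
                       (trans (cong (_↑ˡ m) (splitAt⁻¹-↑ˡ eq₂)) (splitAt⁻¹-↑ˡ eq₁))

  position : Part → ℕ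
  position (X i) = toℕ i
  position (Y i) = q + toℕ i
  position (A j) = q + q + toℕ j
  position (B j) = q + q + m + toℕ j

  toℕ-vertex : ∀ p → toℕ (vertex p) ≡ position p
  toℕ-vertex (X i) = trans (toℕ-↑ˡ _ m) (trans (toℕ-↑ˡ _ m) (toℕ-↑ˡ i q))
  toℕ-vertex (Y i) = trans (toℕ-↑ˡ _ m) (trans (toℕ-↑ˡ _ m) (toℕ-↑ʳ q i))
  toℕ-vertex (A j) = trans (toℕ-↑ˡ _ m) (toℕ-↑ʳ (q + q) j)
  toℕ-vertex (B j) = toℕ-↑ʳ (q + q + m) j

  arc-increasing : ∀ {p p'} → Arc p p' → position p < position p'
  arc-increasing (X→Y {i}) = <-≤-trans (toℕ<n i) (m≤m+n q _)
  arc-increasing (X→A {i} _) = <-≤-trans (toℕ<n i) (≤-trans (m≤m+n q q) (m≤m+n (q + q) _))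
  arc-increasing (Y→B {i} _) = <-≤-trans (+-monoʳ-< q (toℕ<n i)) (≤-trans (m≤m+n (q + q) m) (m≤m+n _ _))

  G : Graph
  G = record
    { n = N
    ; adj = λ u v → does (adjacent? (part u) (part v))
    ; irrefl = λ u → dec-false (adjacent? (part u) (part u)) [ arc-irreflexive , arc-irreflexive ]′
    ; sym = λ u v → ∨-comm (does (arc? (part u) (part v))) (does (arc? (part v) (part u)))
    }

  adj-vertex : ∀ p p' → adj G (vertex p) (vertex p') ≡ does (adjacent? p p')
  adj-vertex p p' = cong₂ (λ s t → does (adjacent? s t)) (part-vertex p) (part-vertex p')

  adjacent⇒adj : ∀ {p p'} → Adjacent p p' → adj G (vertex p) (vertex p') ≡ true
  adjacent⇒adj {p} {p'} p~p' = trans (adj-vertex p p') (dec-true (adjacent? p p') p~p')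

  arc⇒edge : ∀ {p p'} → Arc p p' → IsEdge G (vertex p , vertex p')
  arc⇒edge {p} {p'} pp' =
    subst₂ _<_ (≡.sym (toℕ-vertex p)) (≡.sym (toℕ-vertex p')) (arc-increasing pp') , adjacent⇒adj (inj₁ pp')

  toℕ≡position : ∀ u → toℕ u ≡ position (part u)
  toℕ≡position u = trans (cong toℕ (≡.sym (vertex-part u))) (toℕ-vertex (part u))

  edge⇒arc : ∀ {u v} → IsEdge G (u , v) → Arc (part u) (part v)
  edge⇒arc {u} {v} (u<v , uv) with dec-true⁻¹ (adjacent? (part u) (part v)) uv
  ... | inj₁ uv-arc = uv-arc
  ... | inj₂ vu-arc = ⊥-elim (<-asym u<v
    (subst₂ _<_ (≡.sym (toℕ≡position v)) (≡.sym (toℕ≡position u)) (arc-increasing vu-arc)))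

  ∑ᴾ : (Part → ℕ) → ℕ
  ∑ᴾ f = ∑[ i < q ] f (X i) + ∑[ i < q ] f (Y i) + ∑[ j < m ] f (A j) + ∑[ j < m ] f (B j)

  ∑ᴾ-cong : ∀ {f g} → (∀ p → f p ≡ g p) → ∑ᴾ f ≡ ∑ᴾ g
  ∑ᴾ-cong f≗g = cong₂ _+_ (cong₂ _+_ (cong₂ _+_ (sum-cong-≗ {q} (f≗g ∘ X)) (sum-cong-≗ {q} (f≗g ∘ Y)))
                                      (sum-cong-≗ {m} (f≗g ∘ A)))
                          (sum-cong-≗ {m} (f≗g ∘ B))

  sum-vertex : (f : Fin N → ℕ) → sum f ≡ ∑ᴾ (f ∘ vertex)
  sum-vertex f = trans (sum-↑ (q + q + m) m f) (cong (_+ ∑[ j < m ] f (vertex (B j)))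
    (trans (sum-↑ (q + q) m (f ∘ (_↑ˡ m))) (cong (_+ ∑[ j < m ] f (vertex (A j)))
      (sum-↑ q q (f ∘ (_↑ˡ m) ∘ (_↑ˡ m))))))

  forward-arc : ∀ p p' → (toℕ (vertex p) <ᵇ toℕ (vertex p')) ∧ adj G (vertex p) (vertex p') ≡ does (arc? p p')
  forward-arc p p' rewrite adj-vertex p p' | toℕ-vertex p | toℕ-vertex p' with arc? p p' | arc? p' p
  ... | yes pp' | _ = cong (_∧ true) (dec-true (position p <? position p') (arc-increasing pp'))
  ... | no _ | yes p'p = cong (_∧ true) (dec-false (position p <? position p') (<-asym (arc-increasing p'p)))
  ... | no _ | no _ = ∧-zeroʳ _

  no-out-degree : ∑ᴾ (λ _ → 0) ≡ 0
  no-out-degree = cong₂ _+_ (cong₂ _+_ (cong₂ _+_ (sum-replicate-zero q) (sum-replicate-zero q)) (sum-replicate-zero m))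
                            (sum-replicate-zero m)

  out-degree : Part → ℕ
  out-degree p = ∑ᴾ (λ p' → 𝟙 (does (arc? p p')))

  edgeCount≡∑out-degree : edgeCount G ≡ ∑ᴾ out-degree
  edgeCount≡∑out-degree = trans (edgeCount≡∑ {G}) (trans (sum-vertex (sum ∘ forward))
    (∑ᴾ-cong λ p → trans (sum-vertex (forward (vertex p))) (∑ᴾ-cong λ p' → cong 𝟙 (forward-arc p p'))))
    where
    forward : Fin N → Fin N → ℕ
    forward u v = 𝟙 ((toℕ u <ᵇ toℕ v) ∧ adj G u v)

  closed-out-degree : Part → ℕ
  closed-out-degree (X i) = q + (m ∸ toℕ i)
  closed-out-degree (Y i) = m ∸ toℕ i
  closed-out-degree (A _) = 0
  closed-out-degree (B _) = 0

  out-degree≡ : ∀ p → out-degree p ≡ closed-out-degree p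
  out-degree≡ (X i) = trans (cong₂ _+_ (cong₂ _+_ (cong₂ _+_ (sum-replicate-zero q) (trans (sum-const q 1) (*-identityʳ q)))
                                                  (sum-count-≤ m (toℕ i)))
                                       (sum-replicate-zero m))
                            (+-identityʳ _)
  out-degree≡ (Y i) = cong₂ _+_ (cong₂ _+_ (cong₂ _+_ (sum-replicate-zero q) (sum-replicate-zero q)) (sum-replicate-zero m))
                                (sum-count-≤ m (toℕ i))
  out-degree≡ (A _) = no-out-degree
  out-degree≡ (B _) = no-out-degree

  edge-count : edgeCount G ≡ q * q + suc m * m
  edge-count = begin
    edgeCount G                              ≡⟨ edgeCount≡∑out-degree ⟩
    ∑ᴾ out-degree                            ≡⟨ ∑ᴾ-cong out-degree≡ ⟩
    ∑ᴾ closed-out-degree                     ≡⟨ cong₂ _+_ (cong₂ _+_ (cong₂ _+_ X-sum (sum-∸ m≤q)) (sum-replicate-zero m))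
                                                          (sum-replicate-zero m) ⟩
    q * q + suc m C 2 + suc m C 2 + 0 + 0    ≡⟨ regroup (q * q) (suc m C 2) ⟩
    q * q + 2 * (suc m C 2)                  ≡⟨ cong (q * q +_) (2*nC2≡n*[n∸1] (suc m)) ⟩
    q * q + suc m * m                        ∎
    where
    open ≡.≡-Reasoning
    m≤q : m ≤ q
    m≤q = m≤m+n m d
    X-sum : ∑[ i < q ] (q + (m ∸ toℕ i)) ≡ q * q + suc m C 2
    X-sum = trans (∑-distrib-+ {q} (λ _ → q) (λ i → m ∸ toℕ i)) (cong₂ _+_ (sum-const q q) (sum-∸ m≤q))
    regroup : ∀ a t → a + t + t + 0 + 0 ≡ a + 2 * t
    regroup = solve-∀

  walk-to-X : (i₀ : Fin q) → ∀ p → Walk G (vertex p) (vertex (X i₀))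
  walk-to-X i₀ = to-X
    where
    from-Y : ∀ j → Walk G (vertex (Y j)) (vertex (X i₀))
    from-Y j = step (adjacent⇒adj {Y j} {X i₀} (inj₂ X→Y)) here
    from-X : ∀ i → Walk G (vertex (X i)) (vertex (X i₀))
    from-X i = step (adjacent⇒adj {X i} {Y i₀} (inj₁ X→Y)) (from-Y i₀)
    to-X : ∀ p → Walk G (vertex p) (vertex (X i₀))
    to-X (X i) = from-X i
    to-X (Y j) = from-Y j
    to-X (A j) = step (adjacent⇒adj {A j} {X (j ↑ˡ d)} (inj₂ (X→A (≤-reflexive (toℕ-↑ˡ j d))))) (from-X (j ↑ˡ d))
    to-X (B j) = step (adjacent⇒adj {B j} {Y (j ↑ˡ d)} (inj₂ (Y→B (≤-reflexive (toℕ-↑ˡ j d))))) (from-Y (j ↑ˡ d))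

  connected : Fin q → Connected G
  connected i₀ = connected-via (vertex (X i₀)) λ u → subst (λ w → Walk G w _) (vertex-part u) (walk-to-X i₀ (part u))

  arcs-linked : ∀ {p₁ p₂ p₃ p₄} → Arc p₁ p₂ → Arc p₃ p₄ →
                ∃₂ λ s t → s ∈ᵉ (p₁ , p₂) × t ∈ᵉ (p₃ , p₄) × Adjacent s t
  arcs-linked (X→Y {i}) (X→Y {j = j}) = X i , Y j , inj₁ refl , inj₂ refl , inj₁ X→Y
  arcs-linked (X→Y {j = j}) (X→A {i} _) = Y j , X i , inj₂ refl , inj₁ refl , inj₂ X→Y
  arcs-linked (X→Y {i}) (Y→B {j} _) = X i , Y j , inj₁ refl , inj₁ refl , inj₁ X→Y
  arcs-linked (X→A {i} _) (X→Y {j = j}) = X i , Y j , inj₁ refl , inj₂ refl , inj₁ X→Y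
  arcs-linked (X→A {i} {j} i≤j) (X→A {i'} {j'} i'≤j') =
    [ (λ i≤j' → X i , A j' , inj₁ refl , inj₂ refl , inj₁ (X→A i≤j'))
    , (λ i'≤j → A j , X i' , inj₂ refl , inj₁ refl , inj₂ (X→A i'≤j)) ]′ (≤-crossed i≤j i'≤j')
  arcs-linked (X→A {i} _) (Y→B {j} _) = X i , Y j , inj₁ refl , inj₁ refl , inj₁ X→Y
  arcs-linked (Y→B {i} _) (X→Y {j}) = Y i , X j , inj₁ refl , inj₁ refl , inj₂ X→Y
  arcs-linked (Y→B {i} _) (X→A {j} _) = Y i , X j , inj₁ refl , inj₁ refl , inj₂ X→Y
  arcs-linked (Y→B {i} {j} i≤j) (Y→B {i'} {j'} i'≤j') =
    [ (λ i≤j' → Y i , B j' , inj₁ refl , inj₂ refl , inj₁ (Y→B i≤j'))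
    , (λ i'≤j → B j , Y i' , inj₂ refl , inj₁ refl , inj₂ (Y→B i'≤j)) ]′ (≤-crossed i≤j i'≤j')

  vertex-∈ᵉ : ∀ {s u v} → s ∈ᵉ (part u , part v) → vertex s ∈ᵉ (u , v)
  vertex-∈ᵉ {u = u} (inj₁ refl) = inj₁ (vertex-part u)
  vertex-∈ᵉ {v = v} (inj₂ refl) = inj₂ (vertex-part v)

  edges-linked : ∀ {e f} → IsEdge G e → IsEdge G f → ∃[ g ] IsEdge G g × Meets G g e × Meets G g f
  edges-linked {_ , _} {_ , _} e-edge f-edge =
    let _ , _ , s∈e , t∈f , s~t = arcs-linked (edge⇒arc e-edge) (edge⇒arc f-edge)
    in linked-by-adjacent {G} (adjacent⇒adj s~t) (vertex-∈ᵉ s∈e) (vertex-∈ᵉ t∈f)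

  ind-match : Fin q → IndMatchNumber G 1
  ind-match i₀ = ind-match-number-1 {G} (arc⇒edge (X→Y {i₀} {i₀})) edges-linked

  endpoint-label : ∀ {I : Set} (label : Part → Maybe I) {p p' k w} → label p ≡ just k → label p' ≡ just k →
                w ∈ᵉ (vertex p , vertex p') → label (part w) ≡ just k
  endpoint-label label {p} p-label _ (inj₁ refl) = trans (cong label (part-vertex p)) p-label
  endpoint-label label {p' = p'} _ p'-label (inj₂ refl) = trans (cong label (part-vertex p')) p'-label

  partner : Fin q → Part
  partner i = [ A , Y ∘ (m ↑ʳ_) ]′ (splitAt m i)

  matched : Fin q ⊎ Fin m → Pair G
  matched (inj₁ i) = vertex (X i) , vertex (partner i)
  matched (inj₂ j) = vertex (Y (j ↑ˡ d)) , vertex (B j)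

  matched-edge : ∀ k → IsEdge G (matched k)
  matched-edge (inj₁ i) with splitAt m i in eq
  ... | inj₁ j = arc⇒edge (X→A (≤-reflexive (trans (cong toℕ (≡.sym (splitAt⁻¹-↑ˡ eq))) (toℕ-↑ˡ j d))))
  ... | inj₂ _ = arc⇒edge X→Y
  matched-edge (inj₂ j) = arc⇒edge (Y→B (≤-reflexive (toℕ-↑ˡ j d)))

  Y-index : Fin m ⊎ Fin d → Fin q ⊎ Fin m
  Y-index = [ inj₂ , inj₁ ∘ (m ↑ʳ_) ]′

  matched-label : Part → Maybe (Fin q ⊎ Fin m)
  matched-label (X i) = just (inj₁ i)
  matched-label (Y i) = just (Y-index (splitAt m i))
  matched-label (A j) = just (inj₁ (j ↑ˡ d))
  matched-label (B j) = just (inj₂ j)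

  matched-labelled : ∀ k {w} → w ∈ᵉ matched k → matched-label (part w) ≡ just k
  matched-labelled (inj₁ i) with splitAt m i in eq
  ... | inj₁ j = endpoint-label matched-label {X i} {A j} refl (cong (just ∘ inj₁) (splitAt⁻¹-↑ˡ eq))
  ... | inj₂ k = endpoint-label matched-label {X i} {Y (m ↑ʳ k)} refl
                   (trans (cong (just ∘ Y-index) (splitAt-↑ʳ m d k))
                          (cong (just ∘ inj₁) (splitAt⁻¹-↑ʳ eq)))
  matched-labelled (inj₂ j) = endpoint-label matched-label {Y (j ↑ˡ d)} {B j}
    (cong (just ∘ Y-index) (splitAt-↑ˡ m j d)) refl

  perfect-matching : List (Pair G)
  perfect-matching = map matched (map (splitAt q) (allFin (q + m)))

  perfect-matching-is-matching : IsMatching G perfect-matching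
  perfect-matching-is-matching =
    labelled-matching {G} matched (matched-label ∘ part) matched-edge matched-labelled
      (Unique-map⁺ splitAt-injective (allFin⁺ (q + m)))
    where
    splitAt-injective : ∀ {k l} → splitAt q k ≡ splitAt q l → k ≡ l
    splitAt-injective {k} {l} eq =
      trans (≡.sym (join-splitAt q m k)) (trans (cong (join q m) eq) (join-splitAt q m l))

  perfect-matching-length : length perfect-matching ≡ q + m
  perfect-matching-length =
    trans (length-map matched (map (splitAt q) (allFin (q + m))))
          (trans (length-map (splitAt q) (allFin (q + m))) (length-tabulate id))

  match : MatchNumber G (q + m)
  match = (perfect-matching , perfect-matching-is-matching , perfect-matching-length) , λ M M-matching →
    *-cancelˡ-≤ 2 (subst (2 * length M ≤_) (N≡2[q+m] q m) (matching-length {G} M-matching))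
    where
    N≡2[q+m] : ∀ q m → q + q + m + m ≡ 2 * (q + m)
    N≡2[q+m] = solve-∀

  diagonal : Fin q → Pair G
  diagonal i = vertex (X i) , vertex (Y i)

  diagonal-label : Part → Maybe (Fin q)
  diagonal-label (X i) = just i
  diagonal-label (Y i) = just i
  diagonal-label (A _) = nothing
  diagonal-label (B _) = nothing

  diagonal-matching : List (Pair G)
  diagonal-matching = map diagonal (allFin q)

  diagonal-is-matching : IsMatching G diagonal-matching
  diagonal-is-matching = labelled-matching {G} diagonal (diagonal-label ∘ part) (λ _ → arc⇒edge X→Y)
    (λ i → endpoint-label diagonal-label {X i} {Y i} refl refl) (allFin⁺ q)

  arc-source-on-diagonal : ∀ {p p'} → Arc p p' → ∃[ i ] vertex p ∈ᵉ diagonal i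
  arc-source-on-diagonal (X→Y {i}) = i , inj₁ refl
  arc-source-on-diagonal (X→A {i} _) = i , inj₁ refl
  arc-source-on-diagonal (Y→B {i} _) = i , inj₂ refl

  diagonal-is-maximal : IsMaximalMatching G diagonal-matching
  diagonal-is-maximal = covering⇒maximal {G} diagonal-is-matching covered
    where
    covered : ∀ {e} → IsEdge G e → ∃[ f ] f ∈ diagonal-matching × Meets G e f
    covered {u , _} e-edge =
      let i , u∈diagonal = arc-source-on-diagonal (edge⇒arc e-edge)
      in diagonal i , ∈-map⁺ diagonal (∈-allFin i)
         , meets {G} (inj₁ refl) (subst (_∈ᵉ diagonal i) (vertex-part u) u∈diagonal)

  side : (Fin q → Part) → List (Fin N)
  side P = map (vertex ∘ P) (allFin q)

  side-length : ∀ P → length (side P) ≡ q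
  side-length P = trans (length-map (vertex ∘ P) (allFin q)) (length-tabulate id)

  side-unique : ∀ P → (∀ {i j} → P i ≡ P j → i ≡ j) → Unique (side P)
  side-unique P P-injective =
    Unique-map⁺ (λ {i} {j} eq → P-injective (trans (≡.sym (part-vertex (P i)))
                                                   (trans (cong part eq) (part-vertex (P j)))))
                (allFin⁺ q)

  side-adj : ∀ P P' {u v} → u ∈ side P → v ∈ side P' → ∃₂ λ i j → adj G u v ≡ does (adjacent? (P i) (P' j))
  side-adj P P' u∈ v∈ with ∈-map⁻ (vertex ∘ P) u∈ | ∈-map⁻ (vertex ∘ P') v∈
  ... | i , _ , refl | j , _ , refl = i , j , adj-vertex (P i) (P' j)

  X-independent : Independent G (side X)
  X-independent u∈ v∈ = let _ , _ , uv = side-adj X X u∈ v∈ in uv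

  Y-independent : Independent G (side Y)
  Y-independent u∈ v∈ = let _ , _ , uv = side-adj Y Y u∈ v∈ in uv

  X-Y-complete : ∀ {u v} → u ∈ side X → v ∈ side Y → adj G u v ≡ true
  X-Y-complete u∈ v∈ = let _ , _ , uv = side-adj X Y u∈ v∈ in uv

  min-match : MinMatchNumber G q
  min-match =
    (diagonal-matching , diagonal-is-maximal , trans (length-map diagonal (allFin q)) (length-tabulate id)) , bound
    where
    bound : ∀ M → IsMaximalMatching G M → q ≤ length M
    bound M M-maximal@((edges , _) , _) with maximal-matching-covers-side {G} M-maximal X-Y-complete
    ... | inj₁ X-covered = subst (_≤ length M) (side-length X)
            (independent-cover-length {G} edges (side-unique X λ { refl → refl }) X-independent X-covered)
    ... | inj₂ Y-covered = subst (_≤ length M) (side-length Y)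
            (independent-cover-length {G} edges (side-unique Y λ { refl → refl }) Y-independent Y-covered)

min-edges≤q*q+[1+m]*m : ∀ {q m} → m ≤ q → 1 ≤ q → MinEdgesAtMost 1 q (q + m) (q * q + suc m * m)
min-edges≤q*q+[1+m]*m {q} {m} m≤q 1≤q with m≤n⇒∃[o]m+o≡n m≤q
... | d , refl = G , connected i₀ , ind-match i₀ , min-match , match , ≤-reflexive edge-count
  where
  open KqqWithHalfGraphs m d using (G; connected; ind-match; min-match; match; edge-count)
  i₀ : Fin q
  i₀ = fromℕ< 1≤q

-- Doubling clears the binomial coefficient; the slack added is the doubled difference of the two sides,
-- a polynomial with nonnegative coefficients in t = m − 1 and d (q = m + 2 + d resp. q = m + d).
f₁-bound : ∀ {q m} → 1 ≤ m → m + 2 ≤ q → q * q + suc m * m ≤ (q + m) * (q ∸ 1) + (m + 2) C 2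
f₁-bound {m = suc t} _ m+2≤q with m≤n⇒∃[o]m+o≡n m+2≤q
... | d , refl = *-cancelˡ-≤ 2 (begin
  2 * (q * q + suc m * m)                               ≤⟨ m≤m+n _ (t * (t + 3) + 2 * t * d) ⟩
  2 * (q * q + suc m * m) + (t * (t + 3) + 2 * t * d)   ≡⟨ expand t d ⟩
  2 * ((q + m) * (q ∸ 1)) + (m + 2) * (m + 2 ∸ 1)       ≡⟨ cong (2 * ((q + m) * (q ∸ 1)) +_) (2*nC2≡n*[n∸1] (m + 2)) ⟨
  2 * ((q + m) * (q ∸ 1)) + 2 * ((m + 2) C 2)           ≡⟨ *-distribˡ-+ 2 ((q + m) * (q ∸ 1)) ((m + 2) C 2) ⟨
  2 * ((q + m) * (q ∸ 1) + (m + 2) C 2)                 ∎)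
  where
  open ≤-Reasoning
  m q : ℕ
  m = suc t
  q = suc t + 2 + d
  expand : ∀ t d → 2 * ((suc t + 2 + d) * (suc t + 2 + d) + suc (suc t) * suc t) + (t * (t + 3) + 2 * t * d)
                 ≡ 2 * ((suc t + 2 + d + suc t) * (t + 2 + d)) + (suc t + 2) * (t + 2)
  expand = solve-∀

f₂-bound : ∀ {q m} → 1 ≤ m → m ≤ q → q * q + suc m * m ≤ 2 * m + (2 * q) C 2
f₂-bound {m = suc t} _ m≤q with m≤n⇒∃[o]m+o≡n m≤q
... | d , refl = *-cancelˡ-≤ 2 (begin
  2 * (q * q + suc m * m)                               ≤⟨ m≤m+n _ (2 * d * (2 * t + d + 1)) ⟩
  2 * (q * q + suc m * m) + 2 * d * (2 * t + d + 1)     ≡⟨ expand t d ⟩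
  2 * (2 * m) + 2 * q * (2 * q ∸ 1)                     ≡⟨ cong (2 * (2 * m) +_) (2*nC2≡n*[n∸1] (2 * q)) ⟨
  2 * (2 * m) + 2 * ((2 * q) C 2)                       ≡⟨ *-distribˡ-+ 2 (2 * m) ((2 * q) C 2) ⟨
  2 * (2 * m + (2 * q) C 2)                             ∎)
  where
  open ≤-Reasoning
  m q : ℕ
  m = suc t
  q = suc t + d
  expand : ∀ t d → 2 * ((suc t + d) * (suc t + d) + suc (suc t) * suc t) + 2 * d * (2 * t + d + 1)
                 ≡ 2 * (2 * suc t) + 2 * (suc t + d) * (t + d + (suc t + d + 0))
  expand = solve-∀

theorem3p2 : (q r : ℕ) → 2 ≤ q → q ≤ r → r ≤ 2 * q ∸ 2 →
    MinEdgesAtMost 1 q q (q * q) ×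
    MinEdgesAtMost 1 q (q + 1) (q * q + 2) ×
    (q + 2 ≤ r →
      MinEdgesAtMost 1 q r
        ((r * (q ∸ 1) + ((r ∸ q + 2) C 2)) ⊓ (2 * (r ∸ q) + ((2 * q) C 2))))
theorem3p2 q r 2≤q q≤r r≤2q∸2 with m≤n⇒∃[o]m+o≡n q≤r
... | m , refl rewrite m+n∸m≡n q m = r≡q , r≡q+1 , q+2≤r
  where
  1≤q : 1 ≤ q
  1≤q = ≤-trans (s≤s z≤n) 2≤q
  r≡q : MinEdgesAtMost 1 q q (q * q)
  r≡q = subst₂ (MinEdgesAtMost 1 q) (+-identityʳ q) (+-identityʳ (q * q)) (min-edges≤q*q+[1+m]*m z≤n 1≤q)
  r≡q+1 : MinEdgesAtMost 1 q (q + 1) (q * q + 2)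
  r≡q+1 = min-edges≤q*q+[1+m]*m 1≤q 1≤q
  q+2≤r : q + 2 ≤ q + m → MinEdgesAtMost 1 q (q + m) (((q + m) * (q ∸ 1) + (m + 2) C 2) ⊓ (2 * m + (2 * q) C 2))
  q+2≤r q+2≤q+m = MinEdgesAtMost-mono (⊓-glb (f₁-bound 1≤m m+2≤q) (f₂-bound 1≤m m≤q))
                                     (min-edges≤q*q+[1+m]*m m≤q 1≤q)
    where
    1≤m : 1 ≤ m
    1≤m = <⇒≤ (+-cancelˡ-≤ q 2 m q+2≤q+m)
    m+2≤q : m + 2 ≤ q
    m+2≤q = +-cancelˡ-≤ q (m + 2) q (begin
      q + (m + 2)  ≡⟨ +-assoc q m 2 ⟨
      q + m + 2    ≤⟨ m≤o∸n⇒m+n≤o (q + m) (≤-trans 2≤q (m≤m+n q (q + 0))) r≤2q∸2 ⟩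
      2 * q        ≡⟨ cong (q +_) (+-identityʳ q) ⟩
      q + q        ∎)
      where open ≤-Reasoning
    m≤q : m ≤ q
    m≤q = ≤-trans (m≤m+n m 2) m+2≤q
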